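{- Let $\mathbb F$ be a field, $\beta,\gamma,\gamma^*,\varrho,\varrho^*\in\mathbb F$, and $\mathbb T=\mathbb T(\beta,\gamma,\gamma^*,\varrho,\varrho^*)$. (i) For each permutation $\sigma$ of $\{1,2,3\}$ there exists an algebra automorphism $\hat\sigma$ of $\mathbb T$ sending $A_i\mapsto A_{\sigma(i)}$ and $A^*_i\mapsto A^*_{\sigma(i)}$ for $i\in\{1,2,3\}$. (ii) The map $S_3\to\mathrm{Aut}(\mathbb T)$, $\sigma\mapsto\hat\sigma$, is a group homomorphism. (iii) This homomorphism is injective.
   Context: $\mathbb T(\beta,\gamma,\gamma^*,\varrho,\varrho^*)$ is the associative unital $\mathbb F$-algebra with generators $A_i,A^*_i$ ($i\in\{1,2,3\}$) and relations $[A_i,A_j]=0$, $[A^*_i,A^*_j]=0$ for all $i,j$; $[A_i,A^*_i]=0$ for all $i$; and for distinct $i,j$: $[A_i,A_i^2A_j^*-\beta A_iA_j^*A_i+A_j^*A_i^2-\gamma(A_iA_j^*+A_j^*A_i)-\varrho A_j^*]=0$ and $[A_j^*,A_j^{*2}A_i-\beta A_j^*A_iA_j^*+A_iA_j^{*2}-\gamma^*(A_j^*A_i+A_iA_j^*)-\varrho^*A_i]=0$, where $[B,C]=BC-CB$. $S_3$ is the symmetric group on $\{1,2,3\}$; $\mathrm{Aut}(\mathbb T)$ is the group of algebra automorphisms of $\mathbb T$ under composition. -}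

module Defs where

open import Level using (Level; _⊔_; suc)
open import Algebra.Bundles using (CommutativeRing)
open import Data.Fin using (Fin)
open import Data.Product using (∃)
open import Relation.Nullary using (¬_)
open import Relation.Binary.PropositionalEquality using (_≡_; _≢_)
open import Data.Fin.Permutation using (Permutation′; _⟨$⟩ʳ_; _∘ₚ_)

record Field (c ℓ : Level) : Set (suc (c ⊔ ℓ)) where
  field
    commutativeRing : CommutativeRing c ℓ
  open CommutativeRing commutativeRing public
  field
    1≉0 : ¬ (1# ≈ 0#)
    inverse : ∀ x → ¬ (x ≈ 0#) → ∃ λ y → (x * y) ≈ 1#

-- The algebra T(β, γ, γ*, ϱ, ϱ*) over F, presented by generators and
-- relations: terms of the free unital associative F-algebra on the
-- generators A i, A* i (i ∈ Fin 3, i.e. {1,2,3}), modulo the congruence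
-- generated by the unital F-algebra axioms and the defining relations.
module TAlg {c ℓ : Level} (F : Field c ℓ)
            (β γ γ* ϱ ϱ* : Field.Carrier F) where

  open Field F using (Carrier; _≈_; _+_; _*_; -_; 0#; 1#)

  infixl 6 _⊕_
  infixl 7 _⊙_

  data Term : Set c where
    sc  : Carrier → Term
    A   : Fin 3 → Term
    A*  : Fin 3 → Term
    _⊕_ : Term → Term → Term
    _⊙_ : Term → Term → Term

  0T 1T : Term
  0T = sc 0#
  1T = sc 1#

  _·ₛ_ : Carrier → Term → Term
  a ·ₛ x = sc a ⊙ x

  _⊖_ : Term → Term → Term
  x ⊖ y = x ⊕ ((- 1#) ·ₛ y)

  [_,_] : Term → Term → Term
  [ x , y ] = (x ⊙ y) ⊖ (y ⊙ x)

  tdA : Fin 3 → Fin 3 → Term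
  tdA i j = ((((A i ⊙ A i ⊙ A* j) ⊖ (β ·ₛ (A i ⊙ A* j ⊙ A i)))
              ⊕ (A* j ⊙ A i ⊙ A i))
              ⊖ (γ ·ₛ ((A i ⊙ A* j) ⊕ (A* j ⊙ A i))))
              ⊖ (ϱ ·ₛ A* j)

  tdA* : Fin 3 → Fin 3 → Term
  tdA* i j = ((((A* j ⊙ A* j ⊙ A i) ⊖ (β ·ₛ (A* j ⊙ A i ⊙ A* j)))
               ⊕ (A i ⊙ A* j ⊙ A* j))
               ⊖ (γ* ·ₛ ((A* j ⊙ A i) ⊕ (A i ⊙ A* j))))
               ⊖ (ϱ* ·ₛ A i)

  infix 4 _≈T_

  data _≈T_ : Term → Term → Set (c ⊔ ℓ) where
    reflT  : ∀ {x} → x ≈T x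
    symT   : ∀ {x y} → x ≈T y → y ≈T x
    transT : ∀ {x y z} → x ≈T y → y ≈T z → x ≈T z
    ⊕-cong : ∀ {x x′ y y′} → x ≈T x′ → y ≈T y′ → x ⊕ y ≈T x′ ⊕ y′
    ⊙-cong : ∀ {x x′ y y′} → x ≈T x′ → y ≈T y′ → x ⊙ y ≈T x′ ⊙ y′
    sc-cong : ∀ {a b} → a ≈ b → sc a ≈T sc b
    ⊕-assoc : ∀ x y z → (x ⊕ y) ⊕ z ≈T x ⊕ (y ⊕ z)
    ⊕-comm  : ∀ x y → x ⊕ y ≈T y ⊕ x
    ⊕-idˡ   : ∀ x → 0T ⊕ x ≈T x
    ⊕-invʳ  : ∀ x → x ⊖ x ≈T 0T
    ⊙-assoc : ∀ x y z → (x ⊙ y) ⊙ z ≈T x ⊙ (y ⊙ z)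
    ⊙-idˡ   : ∀ x → 1T ⊙ x ≈T x
    ⊙-idʳ   : ∀ x → x ⊙ 1T ≈T x
    distribˡ : ∀ x y z → x ⊙ (y ⊕ z) ≈T (x ⊙ y) ⊕ (x ⊙ z)
    distribʳ : ∀ x y z → (y ⊕ z) ⊙ x ≈T (y ⊙ x) ⊕ (z ⊙ x)
    -- F-algebra structure: scalars form a central copy of F
    sc-+ : ∀ a b → sc (a + b) ≈T sc a ⊕ sc b
    sc-* : ∀ a b → sc (a * b) ≈T sc a ⊙ sc b
    sc-central : ∀ a x → sc a ⊙ x ≈T x ⊙ sc a
    rel-AA   : ∀ i j → [ A i , A j ] ≈T 0T
    rel-A*A* : ∀ i j → [ A* i , A* j ] ≈T 0T
    rel-AA*  : ∀ i → [ A i , A* i ] ≈T 0T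
    rel-TD   : ∀ i j → i ≢ j → [ A i , tdA i j ] ≈T 0T
    rel-TD*  : ∀ i j → i ≢ j → [ A* j , tdA* i j ] ≈T 0T

  record Aut : Set (c ⊔ ℓ) where
    field
      fun      : Term → Term
      fun-cong : ∀ {x y} → x ≈T y → fun x ≈T fun y
      fun-⊕    : ∀ x y → fun (x ⊕ y) ≈T fun x ⊕ fun y
      fun-⊙    : ∀ x y → fun (x ⊙ y) ≈T fun x ⊙ fun y
      fun-sc   : ∀ a → fun (sc a) ≈T sc a
      inv      : Term → Term
      inv-cong : ∀ {x y} → x ≈T y → inv x ≈T inv y
      fun-inv  : ∀ x → fun (inv x) ≈T x
      inv-fun  : ∀ x → inv (fun x) ≈T x

  open Aut public

  _≈Aut_ : Aut → Aut → Set (c ⊔ ℓ)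
  φ ≈Aut ψ = ∀ x → fun φ x ≈T fun ψ x

  _∘Aut_ : Aut → Aut → Aut
  φ ∘Aut ψ = record
    { fun      = λ x → fun φ (fun ψ x)
    ; fun-cong = λ e → fun-cong φ (fun-cong ψ e)
    ; fun-⊕    = λ x y → transT (fun-cong φ (fun-⊕ ψ x y)) (fun-⊕ φ _ _)
    ; fun-⊙    = λ x y → transT (fun-cong φ (fun-⊙ ψ x y)) (fun-⊙ φ _ _)
    ; fun-sc   = λ a → transT (fun-cong φ (fun-sc ψ a)) (fun-sc φ a)
    ; inv      = λ x → inv ψ (inv φ x)
    ; inv-cong = λ e → inv-cong ψ (inv-cong φ e)
    ; fun-inv  = λ x → transT (fun-cong φ (fun-inv ψ _)) (fun-inv φ x)
    ; inv-fun  = λ x → transT (inv-cong ψ (inv-fun φ _)) (inv-fun ψ x)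
    }

-- Composition in S_3 in the usual (right-to-left) convention:
-- (σ ∘S τ)(i) = σ(τ(i)).  (stdlib's _∘ₚ_ is diagrammatic: τ ∘ₚ σ.)
_∘S_ : Permutation′ 3 → Permutation′ 3 → Permutation′ 3
σ ∘S τ = τ ∘ₚ σ

_≈S_ : Permutation′ 3 → Permutation′ 3 → Set
σ ≈S τ = ∀ i → σ ⟨$⟩ʳ i ≡ τ ⟨$⟩ʳ i

-- Renaming the indices of the generators by a permutation σ maps every defining
-- relation of T to another defining relation (the side condition i ≢ j survives
-- because σ is injective), so it descends to an endomorphism of T; renaming is
-- functorial, so the inverse permutation gives the inverse and σ ↦ σ̂ is a
-- homomorphism.  For injectivity, F is commutative, so A i ↦ [i = k], A* i ↦ 0
-- kills every commutator and defines a character T → F; it separates A i from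
-- A j whenever i ≢ j.

module Submission where

open import Defs
open import Level using (Level)
open import Algebra.Bundles using (CommutativeRing)
import Algebra.Properties.Ring as RingProperties
open import Data.Bool.Base using (if_then_else_)
open import Data.Fin.Base using (Fin)
open import Data.Fin.Properties using (_≟_)
open import Data.Fin.Permutation using (Permutation′; _⟨$⟩ʳ_; flip; inverseˡ; inverseʳ)
open import Data.Product using (Σ; _×_; _,_)
open import Function.Base using (id; _∘_)
open import Function.Bundles using (Injection)
open import Function.Definitions using (Injective)
open import Function.Properties.Inverse using (↔⇒↣)
open import Relation.Nullary using (does; yes; no; contradiction)
open import Relation.Binary.PropositionalEquality
  using (_≡_; _≗_; refl; sym; cong; cong₂)

module _ {c ℓ : Level} (R : CommutativeRing c ℓ) where
  open CommutativeRing R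
  open RingProperties ring using (-1*x≈-x)

  x+-1*x≈0 : ∀ x → x + - 1# * x ≈ 0#
  x+-1*x≈0 x = trans (+-congˡ (-1*x≈-x x)) (-‿inverseʳ x)

  xy+-1*yx≈0 : ∀ x y → x * y + - 1# * (y * x) ≈ 0#
  xy+-1*yx≈0 x y = trans (+-congˡ (*-congˡ (*-comm y x))) (x+-1*x≈0 (x * y))

module _ {c ℓ : Level} (F : Field c ℓ) (β γ γ* ϱ ϱ* : Field.Carrier F) where
  open TAlg F β γ γ* ϱ ϱ*
  open Field F using (Carrier; 1#; 0#; _+_; _*_; _≈_; 1≉0)
  module F = Field F

  ≡⇒≈T : ∀ {x y} → x ≡ y → x ≈T y
  ≡⇒≈T refl = reflT

  rename : (Fin 3 → Fin 3) → Term → Term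
  rename f (sc a)  = sc a
  rename f (A i)   = A (f i)
  rename f (A* i)  = A* (f i)
  rename f (x ⊕ y) = rename f x ⊕ rename f y
  rename f (x ⊙ y) = rename f x ⊙ rename f y

  rename-cong : ∀ {f} → Injective _≡_ _≡_ f → ∀ {x y} → x ≈T y → rename f x ≈T rename f y
  rename-cong inj reflT              = reflT
  rename-cong inj (symT e)           = symT (rename-cong inj e)
  rename-cong inj (transT e e′)      = transT (rename-cong inj e) (rename-cong inj e′)
  rename-cong inj (⊕-cong e e′)      = ⊕-cong (rename-cong inj e) (rename-cong inj e′)
  rename-cong inj (⊙-cong e e′)      = ⊙-cong (rename-cong inj e) (rename-cong inj e′)
  rename-cong inj (sc-cong a≈b)      = sc-cong a≈b
  rename-cong inj (⊕-assoc x y z)    = ⊕-assoc _ _ _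
  rename-cong inj (⊕-comm x y)       = ⊕-comm _ _
  rename-cong inj (⊕-idˡ x)          = ⊕-idˡ _
  rename-cong inj (⊕-invʳ x)         = ⊕-invʳ _
  rename-cong inj (⊙-assoc x y z)    = ⊙-assoc _ _ _
  rename-cong inj (⊙-idˡ x)          = ⊙-idˡ _
  rename-cong inj (⊙-idʳ x)          = ⊙-idʳ _
  rename-cong inj (distribˡ x y z)   = distribˡ _ _ _
  rename-cong inj (distribʳ x y z)   = distribʳ _ _ _
  rename-cong inj (sc-+ a b)         = sc-+ a b
  rename-cong inj (sc-* a b)         = sc-* a b
  rename-cong inj (sc-central a x)   = sc-central a _
  rename-cong {f} inj (rel-AA i j)   = rel-AA (f i) (f j)
  rename-cong {f} inj (rel-A*A* i j) = rel-A*A* (f i) (f j)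
  rename-cong {f} inj (rel-AA* i)    = rel-AA* (f i)
  rename-cong {f} inj (rel-TD i j i≢j)  = rel-TD (f i) (f j) (i≢j ∘ inj)
  rename-cong {f} inj (rel-TD* i j i≢j) = rel-TD* (f i) (f j) (i≢j ∘ inj)

  rename-∘ : ∀ f g x → rename f (rename g x) ≡ rename (f ∘ g) x
  rename-∘ f g (sc a)  = refl
  rename-∘ f g (A i)   = refl
  rename-∘ f g (A* i)  = refl
  rename-∘ f g (x ⊕ y) = cong₂ _⊕_ (rename-∘ f g x) (rename-∘ f g y)
  rename-∘ f g (x ⊙ y) = cong₂ _⊙_ (rename-∘ f g x) (rename-∘ f g y)

  rename-id : ∀ {f} → f ≗ id → ∀ x → rename f x ≡ x
  rename-id f≗id (sc a)  = refl
  rename-id f≗id (A i)   = cong A (f≗id i)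
  rename-id f≗id (A* i)  = cong A* (f≗id i)
  rename-id f≗id (x ⊕ y) = cong₂ _⊕_ (rename-id f≗id x) (rename-id f≗id y)
  rename-id f≗id (x ⊙ y) = cong₂ _⊙_ (rename-id f≗id x) (rename-id f≗id y)

  rename-inverse : ∀ {f g} → f ∘ g ≗ id → ∀ x → rename f (rename g x) ≈T x
  rename-inverse {f} {g} f∘g≗id x =
    transT (≡⇒≈T (rename-∘ f g x)) (≡⇒≈T (rename-id f∘g≗id x))

  permute : Permutation′ 3 → Aut
  permute σ = record
    { fun      = rename (σ ⟨$⟩ʳ_)
    ; fun-cong = rename-cong (Injection.injective (↔⇒↣ σ))
    ; fun-⊕    = λ _ _ → reflT
    ; fun-⊙    = λ _ _ → reflT
    ; fun-sc   = λ _ → reflT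
    ; inv      = rename (flip σ ⟨$⟩ʳ_)
    ; inv-cong = rename-cong (Injection.injective (↔⇒↣ (flip σ)))
    ; fun-inv  = rename-inverse (λ _ → inverseʳ σ)
    ; inv-fun  = rename-inverse (λ _ → inverseˡ σ)
    }

  permute-∘ : ∀ σ τ → permute (σ ∘S τ) ≈Aut (permute σ ∘Aut permute τ)
  permute-∘ σ τ x = symT (≡⇒≈T (rename-∘ (σ ⟨$⟩ʳ_) (τ ⟨$⟩ʳ_) x))

  evaluate : (Fin 3 → Carrier) → (Fin 3 → Carrier) → Term → Carrier
  evaluate a a* (sc b)  = b
  evaluate a a* (A i)   = a i
  evaluate a a* (A* i)  = a* i
  evaluate a a* (x ⊕ y) = evaluate a a* x + evaluate a a* y
  evaluate a a* (x ⊙ y) = evaluate a a* x * evaluate a a* y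

  evaluate-cong : ∀ a a* {x y} → x ≈T y → evaluate a a* x ≈ evaluate a a* y
  evaluate-cong a a* reflT              = F.refl
  evaluate-cong a a* (symT e)           = F.sym (evaluate-cong a a* e)
  evaluate-cong a a* (transT e e′)      = F.trans (evaluate-cong a a* e) (evaluate-cong a a* e′)
  evaluate-cong a a* (⊕-cong e e′)      = F.+-cong (evaluate-cong a a* e) (evaluate-cong a a* e′)
  evaluate-cong a a* (⊙-cong e e′)      = F.*-cong (evaluate-cong a a* e) (evaluate-cong a a* e′)
  evaluate-cong a a* (sc-cong b≈b′)     = b≈b′
  evaluate-cong a a* (⊕-assoc x y z)    = F.+-assoc _ _ _
  evaluate-cong a a* (⊕-comm x y)       = F.+-comm _ _
  evaluate-cong a a* (⊕-idˡ x)          = F.+-identityˡ _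
  evaluate-cong a a* (⊕-invʳ x)         = x+-1*x≈0 F.commutativeRing _
  evaluate-cong a a* (⊙-assoc x y z)    = F.*-assoc _ _ _
  evaluate-cong a a* (⊙-idˡ x)          = F.*-identityˡ _
  evaluate-cong a a* (⊙-idʳ x)          = F.*-identityʳ _
  evaluate-cong a a* (distribˡ x y z)   = F.distribˡ _ _ _
  evaluate-cong a a* (distribʳ x y z)   = F.distribʳ _ _ _
  evaluate-cong a a* (sc-+ b b′)        = F.refl
  evaluate-cong a a* (sc-* b b′)        = F.refl
  evaluate-cong a a* (sc-central b x)   = F.*-comm _ _
  evaluate-cong a a* (rel-AA i j)       = xy+-1*yx≈0 F.commutativeRing _ _
  evaluate-cong a a* (rel-A*A* i j)     = xy+-1*yx≈0 F.commutativeRing _ _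
  evaluate-cong a a* (rel-AA* i)        = xy+-1*yx≈0 F.commutativeRing _ _
  evaluate-cong a a* (rel-TD i j _)     = xy+-1*yx≈0 F.commutativeRing _ _
  evaluate-cong a a* (rel-TD* i j _)    = xy+-1*yx≈0 F.commutativeRing _ _

  indicator : Fin 3 → Fin 3 → Carrier
  indicator i k = if does (k ≟ i) then 1# else 0#

  A-injective : ∀ {i j} → A i ≈T A j → i ≡ j
  A-injective {i} {j} e with i ≟ i | j ≟ i | evaluate-cong (indicator i) (λ _ → 0#) e
  ... | _       | yes j≡i | _   = sym j≡i
  ... | yes _   | no _    | 1≈0 = contradiction 1≈0 1≉0
  ... | no i≢i  | no _    | _   = contradiction refl i≢i

  permute-injective : ∀ σ τ → permute σ ≈Aut permute τ → σ ≈S τ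
  permute-injective σ τ σ̂≈τ̂ i = A-injective (σ̂≈τ̂ (A i))

lemma4p9 : {c ℓ : Level} (F : Field c ℓ) (β γ γ* ϱ ϱ* : Field.Carrier F) →
    let open TAlg F β γ γ* ϱ ϱ* in
    Σ (Permutation′ 3 → Aut) λ hat →
      -- (i) hat σ sends A i ↦ A (σ i), A* i ↦ A* (σ i)
      (∀ σ i → (fun (hat σ) (A i) ≈T A (σ ⟨$⟩ʳ i))
             × (fun (hat σ) (A* i) ≈T A* (σ ⟨$⟩ʳ i)))
      -- (ii) σ ↦ hat σ is a group homomorphism S₃ → Aut(T)
      × (∀ σ τ → hat (σ ∘S τ) ≈Aut (hat σ ∘Aut hat τ))
      -- (iii) it is injective
      × (∀ σ τ → hat σ ≈Aut hat τ → σ ≈S τ)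
lemma4p9 F β γ γ* ϱ ϱ* =
    permute F β γ γ* ϱ ϱ*
  , (λ σ i → TAlg.reflT , TAlg.reflT)
  , permute-∘ F β γ γ* ϱ ϱ*
  , permute-injective F β γ γ* ϱ ϱ*
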